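{- Fix an integer $\ell\geqslant 14$, let $c=6\ell-5$, and let $G$ be a $C_{2\ell}$-saturated graph. Let $M$, $A$, $B$, $D_0,D_1,\ldots,D_{\ell-2}$, $D$, the black and gray edges, $g$, $T_v$ and $g(T_v)$ be as in the context. Let $v\in D$. Then: (i) if $g(T_v)=0$, then $\deg_G(v)=1$; (ii) if $g(T_v)=1$, then $T_v$ is a path and the unique gray half-edge incident with a vertex of $T_v$ is incident with an endpoint of $T_v$; moreover, this gray half-edge is incident with $v$ if and only if either $V(T_v)=\{v\}$, or $V(T_v)=\{v,w\}$ for some vertex $w$ with $\deg_G(w)=1$.
   Context: All graphs are finite, simple, undirected; $G$ is $C_{2\ell}$-saturated if it has no subgraph isomorphic to $C_{2\ell}$ but adding any edge between nonadjacent vertices creates one. Call a vertex $v$ admissible if every vertex at distance at most $\ell-2$ from $v$ has degree less than $c$, and for admissible $v$ put $D(v)=\{x\mid d_G(v,x)\leqslant\ell-1\}$. Let $\mathcal{P}$ be a maximal family of pairwise vertex-disjoint paths of length $2\ell-4$ all of whose vertices have degree $2$ in $G$, $S_0$ the set of their middle vertices, $S\supseteq S_0$ a maximal set of admissible vertices with $D(x)\cap D(y)=\varnothing$ for distinct $x,y\in S$, and $M=\bigcup_{x\in S}D(x)$. Let $A$ be the set of degree-one vertices of $V(G)\setminus M$ adjacent to a vertex of $M$; $B$ the set of vertices of $V(G)\setminus M$ of degree at least $c$; $D_0$ the set of vertices of $V(G)\setminus(M\cup A\cup B)$ having a neighbor in $M$; and for $i\geqslant1$, $D_i$ the set of vertices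 of $V(G)\setminus(M\cup A\cup B\cup D_0)$ at distance exactly $i$ from $B\cup D_0$. The sets $M,A,B,D_0,D_1,\ldots,D_{\ell-2}$ partition $V(G)$; put $D=D_1\cup\cdots\cup D_{\ell-2}$ and $D_{ -1}=M$. For each $i\in\{0,\ldots,\ell-2\}$ and each $v\in D_i$, one edge joining $v$ to a vertex of $B\cup D_{i-1}$ is designated (arbitrarily) and colored black; all other edges of $G$ are gray. Each gray edge $e=xy$ gives two gray half-edges $(x,e)$ and $(y,e)$, and $g(v)$ denotes the number of gray half-edges incident with $v$ (i.e. the number of gray edges at $v$). For $v\in D$, following black edges from $v$ gives a unique path from $v$ to $D_1$; let $P_v$ be its vertex set. $T_v$ is the tree with $V(T_v)=\{x\mid x\in D,\ v\in P_x\}$ and edge set the black edges with both endpoints in $V(T_v)$, and $g(T_v)=\sum_{x\in V(T_v)}g(x)$. -}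

module Defs where

open import Data.Nat using (ℕ; zero; suc; _+_; _*_; _∸_; _≤_; _<_; _≡ᵇ_; _≤ᵇ_)
open import Data.Bool using (Bool; true; false; _∧_; _∨_; not; if_then_else_; T)
open import Data.Fin using (Fin; toℕ)
open import Data.Fin.Properties using (_≟_)
open import Data.Fin.Subset using (Subset; ⁅_⁆; _∈_; _∉_; _⊆_; _∪_; ∣_∣)
open import Data.Vec using (tabulate; lookup)
open import Data.List using (List; map; allFin)
open import Data.Nat.ListAction using (sum)
import Data.Bool.ListAction as BL
open import Data.List.Relation.Unary.All using (All)
open import Data.List.Relation.Unary.Any using (Any)
open import Data.List.Relation.Unary.AllPairs using (AllPairs)
open import Data.Product using (Σ; _×_; ∃; ∃-syntax)
open import Data.Sum using (_⊎_)
open import Relation.Nullary using (¬_)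
open import Relation.Nullary.Decidable using (⌊_⌋)
open import Relation.Binary.PropositionalEquality using (_≡_; _≢_)
open import Data.Empty using (⊥)
open import Function.Bundles using (_⇔_)

record Graph (n : ℕ) : Set where
  field
    adj    : Fin n → Fin n → Bool
    adj-sym : ∀ x y → adj x y ≡ adj y x
    adj-irr : ∀ x → adj x x ≡ false

anyFin : ∀ {n} → (Fin n → Bool) → Bool
anyFin {n} p = BL.any p (allFin n)

anyUpTo : ℕ → (ℕ → Bool) → Bool
anyUpTo zero    p = p zero
anyUpTo (suc k) p = anyUpTo k p ∨ p (suc k)

anyBelow : ℕ → (ℕ → Bool) → Bool
anyBelow zero    p = false
anyBelow (suc k) p = anyUpTo k p

sumFin : ∀ {n} → (Fin n → ℕ) → ℕ
sumFin {n} f = sum (map f (allFin n))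

iter : ∀ {A : Set} → (A → A) → ℕ → A → A
iter f zero    x = x
iter f (suc j) x = f (iter f j x)

-- Cycles C_k as subgraphs (injective homomorphic images of the k-cycle),
-- for an arbitrary adjacency relation on Fin n.  The cycle's vertices are
-- f 0, ..., f (k-1).

HasCycle : ∀ {n} → (Fin n → Fin n → Bool) → ℕ → Set
HasCycle {n} a k =
  Σ (ℕ → Fin n) λ f →
      (∀ i j → i < k → j < k → f i ≡ f j → i ≡ j)
    × (∀ i → suc i < k → T (a (f i) (f (suc i))))
    × T (a (f (k ∸ 1)) (f zero))

addEdge : ∀ {n} → (Fin n → Fin n → Bool) → Fin n → Fin n → (Fin n → Fin n → Bool)
addEdge a u v x y =
  a x y ∨ ((⌊ x ≟ u ⌋ ∧ ⌊ y ≟ v ⌋) ∨ (⌊ x ≟ v ⌋ ∧ ⌊ y ≟ u ⌋))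

Saturated : ∀ {n} → Graph n → ℕ → Set
Saturated G ℓ =
    ¬ HasCycle (Graph.adj G) (2 * ℓ)
  × (∀ u v → u ≢ v → Graph.adj G u v ≡ false →
       HasCycle (addEdge (Graph.adj G) u v) (2 * ℓ))

module Construction {n : ℕ} (G : Graph n) (ℓ : ℕ) where
  open Graph G

  c : ℕ
  c = 6 * ℓ ∸ 5

  Adj : Fin n → Fin n → Set
  Adj x y = T (adj x y)

  deg : Fin n → ℕ
  deg x = ∣ tabulate (adj x) ∣

  nbhd : Subset n → Subset n
  nbhd X = tabulate λ y → anyFin λ x → lookup X x ∧ adj x y

  -- ball X k = { y | d_G(X, y) ≤ k }  (breadth-first layers)
  ball : Subset n → ℕ → Subset n
  ball X zero    = X
  ball X (suc k) = ball X k ∪ nbhd (ball X k)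

  dist≤ : Fin n → Fin n → ℕ → Set
  dist≤ v x k = x ∈ ball ⁅ v ⁆ k

  Admissible : Fin n → Set
  Admissible v = ∀ x → dist≤ v x (ℓ ∸ 2) → deg x < c

  Dball : Fin n → Subset n
  Dball v = ball ⁅ v ⁆ (ℓ ∸ 1)

  IsDeg2Path : (ℕ → Fin n) → Set
  IsDeg2Path p =
      (∀ i j → i ≤ 2 * ℓ ∸ 4 → j ≤ 2 * ℓ ∸ 4 → p i ≡ p j → i ≡ j)
    × (∀ i → i < 2 * ℓ ∸ 4 → Adj (p i) (p (suc i)))
    × (∀ i → i ≤ 2 * ℓ ∸ 4 → deg (p i) ≡ 2)

  VertexDisjoint : (ℕ → Fin n) → (ℕ → Fin n) → Set
  VertexDisjoint p q = ∀ i j → i ≤ 2 * ℓ ∸ 4 → j ≤ 2 * ℓ ∸ 4 → p i ≢ q j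

  middle : (ℕ → Fin n) → Fin n
  middle p = p (ℓ ∸ 2)

  MaximalPathFamily : List (ℕ → Fin n) → Set
  MaximalPathFamily P =
      All IsDeg2Path P
    × AllPairs VertexDisjoint P
    × (∀ q → IsDeg2Path q → Any (λ p → ¬ VertexDisjoint p q) P)

  GoodSet : Subset n → Set
  GoodSet S =
      (∀ x → x ∈ S → Admissible x)
    × (∀ x y → x ∈ S → y ∈ S → x ≢ y → ∀ z → z ∈ Dball x → z ∉ Dball y)

  MaximalGoodSet : List (ℕ → Fin n) → Subset n → Set
  MaximalGoodSet P S =
      All (λ p → middle p ∈ S) P
    × GoodSet S
    × (∀ S' → S ⊆ S' → GoodSet S' → S' ⊆ S)

  module WithS (S : Subset n) where

    Mset : Subset n
    Mset = tabulate λ y → anyFin λ x → lookup S x ∧ lookup (Dball x) y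

    Aset : Subset n
    Aset = tabulate λ y →
      not (lookup Mset y) ∧ (deg y ≡ᵇ 1) ∧ anyFin (λ x → adj y x ∧ lookup Mset x)

    Bset : Subset n
    Bset = tabulate λ y → not (lookup Mset y) ∧ (c ≤ᵇ deg y)

    MAB : Subset n
    MAB = Mset ∪ (Aset ∪ Bset)

    D₀ : Subset n
    D₀ = tabulate λ y →
      not (lookup MAB y) ∧ anyFin (λ x → adj y x ∧ lookup Mset x)

    BD₀ : Subset n
    BD₀ = Bset ∪ D₀

    -- layer i : D_i  (i ≥ 1: distance exactly i from B ∪ D₀)
    layer : ℕ → Subset n
    layer zero    = D₀
    layer (suc i) = tabulate λ y →
      not (lookup (MAB ∪ D₀) y)
      ∧ lookup (ball BD₀ (suc i)) y ∧ not (lookup (ball BD₀ i) y)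

    -- D_{i-1}, with D_{-1} = M
    prevLayer : ℕ → Subset n
    prevLayer zero    = Mset
    prevLayer (suc i) = layer i

    inD₀₊ : Fin n → Bool
    inD₀₊ y = anyUpTo (ℓ ∸ 2) λ i → lookup (layer i) y

    inD : Fin n → Bool
    inD y = anyUpTo (ℓ ∸ 2) λ i → not (i ≡ᵇ 0) ∧ lookup (layer i) y

    -- a designation of black edges: par v is the designated neighbour
    -- of v ∈ D_i (0 ≤ i ≤ ℓ-2), lying in B ∪ D_{i-1}
    ValidParent : (Fin n → Fin n) → Set
    ValidParent par = ∀ i v → i ≤ ℓ ∸ 2 → v ∈ layer i →
      Adj v (par v) × par v ∈ (Bset ∪ prevLayer i)

    module WithPar (par : Fin n → Fin n) where

      black : Fin n → Fin n → Bool
      black x y = (inD₀₊ x ∧ ⌊ par x ≟ y ⌋) ∨ (inD₀₊ y ∧ ⌊ par y ≟ x ⌋)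

      gray : Fin n → Fin n → Bool
      gray x y = adj x y ∧ not (black x y)

      g : Fin n → ℕ
      g x = ∣ tabulate (gray x) ∣

      -- u ∈ P_x : x ∈ D_i (1 ≤ i ≤ ℓ-2) and u is one of
      -- x, par x, ..., par^{i-1} x  (the black path from x down to D₁)
      inP : Fin n → Fin n → Bool
      inP x u = anyUpTo (ℓ ∸ 2) λ i →
        not (i ≡ᵇ 0) ∧ lookup (layer i) x ∧
        anyBelow i (λ j → ⌊ iter par j x ≟ u ⌋)

      VT : Fin n → Subset n
      VT v = tabulate λ x → inD x ∧ inP x v

      TEdge : Fin n → Fin n → Fin n → Set
      TEdge v x y = x ∈ VT v × y ∈ VT v × T (black x y)

      gT : Fin n → ℕ
      gT v = sumFin λ x → if lookup (VT v) x then g x else 0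

      -- T_v is a path u 0 — u 1 — ... — u m ; its endpoints are u 0 and u m.
      PathWithGrayAtEnd : Fin n → Set
      PathWithGrayAtEnd v =
        Σ ℕ λ m → Σ (ℕ → Fin n) λ u →
            (∀ i j → i ≤ m → j ≤ m → u i ≡ u j → i ≡ j)
          × (∀ x → x ∈ VT v ⇔ (∃[ i ] (i ≤ m × u i ≡ x)))
          × (∀ i j → i ≤ m → j ≤ m →
               TEdge v (u i) (u j) ⇔ (j ≡ suc i ⊎ i ≡ suc j))
          × (∀ x y → x ∈ VT v → T (gray x y) → (x ≡ u 0 ⊎ x ≡ u m))

      GrayAtRootCriterion : Fin n → Set
      GrayAtRootCriterion v =
        ∀ x y → x ∈ VT v → T (gray x y) →
          (x ≡ v) ⇔
            ((∀ z → z ∈ VT v ⇔ z ≡ v)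
             ⊎ (∃[ w ] (w ≢ v × deg w ≡ 1 × (∀ z → z ∈ VT v ⇔ (z ≡ v ⊎ z ≡ w)))))

{-# OPTIONS --safe #-}
module Submission where

-- Saturation enters only through one consequence: any two distinct non-adjacent vertices
-- are the ends of a path with 2ℓ - 1 edges, while G has no 2ℓ-cycle.  Such a path cannot
-- pass through a leaf, so two leaves never hang at the same vertex, and a vertex x all of
-- whose neighbours other than p are leaves at x is itself a leaf at p.
--
-- A vertex of T_v without gray half-edges is adjacent only to its parent and its children,
-- so if g vanishes on T_x, induction from the deepest layer makes x a leaf: this is (i).
-- For (ii) let y carry the gray half-edge and let y, par y, …, v be its black path.  Every
-- other vertex of T_v has a gray-free subtree, hence is a leaf.  Such a leaf cannot hang at
-- a vertex of the path below v: a saturating path from it to the grandparent of that vertex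
-- would close into a 2ℓ-cycle.  So it hangs at v, and there is at most one.  Thus T_v is the
-- path from y to v, possibly extended by a single leaf w at v, and the gray half-edge sits
-- at its end y, which is v exactly when V(T_v) is {v} or {v, w}.


open import Defs
open import Data.Nat using (ℕ; zero; suc; _+_; _*_; _∸_; _≤_; _<_; z≤n; s≤s; _<?_; _≡ᵇ_)
open import Data.Nat.Properties hiding (_≟_)
open import Data.Bool using (Bool; true; false; T; not; _∧_; if_then_else_)
open import Data.Bool.Properties using (T-≡; T-∧; T-∨; ¬-not)
open import Data.Fin using (Fin; zero; suc)
open import Data.Fin.Properties using (_≟_; any?)
open import Data.Fin.Subset using (Subset; _∈_; _∉_; _⊆_; _∪_; ⁅_⁆; _-_; ∣_∣)
open import Data.Fin.Subset.Properties using (x∈⁅y⁆⇒x≡y; x∈⁅x⁆; ∣⁅x⁆∣≡1; p⊆q⇒∣p∣≤∣q∣; x∈p∧x≢y⇒x∈p-y; x∈p⇒∣p-x∣<∣p∣; p⊆p∪q; q⊆p∪q; x∈p∪q⁻; _∈?_)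
open import Data.Vec using (tabulate; lookup)
open import Data.Vec.Properties using (lookup∘tabulate; []=⇒lookup; lookup⇒[]=)
open import Data.List using (List)
open import Data.List.Properties using (map-tabulate)
import Data.List.Relation.Unary.Any as Any
open import Data.List.Relation.Unary.Any.Properties using (any⁺)
open import Data.List.Membership.Propositional.Properties using (∈-allFin)
open import Data.Nat.ListAction using (sum)
import Data.Product as Product
open import Data.Product using (_×_; _,_; proj₁; proj₂; ∃; ∃-syntax)
import Data.Sum as Sum
open import Data.Sum using (_⊎_; inj₁; inj₂)
open import Data.Empty using (⊥; ⊥-elim)
open import Data.Unit using (tt)
open import Relation.Binary.Definitions using (tri<; tri≈; tri>)
open import Function using (_∘_; id; flip)
open import Function.Bundles using (_⇔_; mk⇔; module Equivalence)
open Equivalence using (to; from)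
open import Relation.Nullary using (¬_; Dec; yes; no; does; contradiction)
open import Relation.Nullary.Decidable using (toSum; _×-dec_; map′; dec-true; dec-false; decidable-stable; T?; ¬?; ⌊_⌋; toWitness; fromWitness)
open import Relation.Binary.PropositionalEquality

module _ {n : ℕ} where

  ∈⇔T-lookup : ∀ {p : Subset n} {x} → x ∈ p ⇔ T (lookup p x)
  ∈⇔T-lookup {p} {x} = mk⇔ (λ x∈p → from T-≡ ([]=⇒lookup x∈p))
                            (λ t → lookup⇒[]= x p (to T-≡ t))

  ∈-tabulate⇔ : ∀ {f : Fin n → Bool} {x} → x ∈ tabulate f ⇔ T (f x)
  ∈-tabulate⇔ {f} {x} = subst (λ b → x ∈ tabulate f ⇔ T b) (lookup∘tabulate f x) ∈⇔T-lookup

  ⁅x⁆⊆p : ∀ {p : Subset n} {x} → x ∈ p → ⁅ x ⁆ ⊆ p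
  ⁅x⁆⊆p {x = x} x∈p y∈⁅x⁆ = subst (_∈ _) (sym (x∈⁅y⁆⇒x≡y x y∈⁅x⁆)) x∈p

  x∈p⇒1≤∣p∣ : ∀ {p : Subset n} {x} → x ∈ p → 1 ≤ ∣ p ∣
  x∈p⇒1≤∣p∣ {x = x} x∈p = subst (_≤ _) (∣⁅x⁆∣≡1 x) (p⊆q⇒∣p∣≤∣q∣ (⁅x⁆⊆p x∈p))

  ∣p∣≡0⇒x∉p : ∀ {p : Subset n} {x} → ∣ p ∣ ≡ 0 → x ∉ p
  ∣p∣≡0⇒x∉p ∣p∣≡0 x∈p = 1+n≰n (subst (1 ≤_) ∣p∣≡0 (x∈p⇒1≤∣p∣ x∈p))

  ∣p∣≡1⇒x≡y : ∀ {p : Subset n} {x y} → ∣ p ∣ ≡ 1 → x ∈ p → y ∈ p → x ≡ y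
  ∣p∣≡1⇒x≡y {p} {x} {y} ∣p∣≡1 x∈p y∈p with x ≟ y
  ... | yes x≡y = x≡y
  ... | no x≢y = contradiction (subst (∣ p - x ∣ <_) ∣p∣≡1 (x∈p⇒∣p-x∣<∣p∣ x∈p))
                               (≤⇒≯ (x∈p⇒1≤∣p∣ (x∈p∧x≢y⇒x∈p-y y∈p (x≢y ∘ sym))))

  ∣p∣≡1 : ∀ {p : Subset n} {x} → x ∈ p → (∀ {y} → y ∈ p → y ≡ x) → ∣ p ∣ ≡ 1
  ∣p∣≡1 {x = x} x∈p p⊆x = ≤-antisym
    (subst (_ ≤_) (∣⁅x⁆∣≡1 x) (p⊆q⇒∣p∣≤∣q∣ (λ y∈p → subst (_∈ ⁅ x ⁆) (sym (p⊆x y∈p)) (x∈⁅x⁆ x))))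
    (x∈p⇒1≤∣p∣ x∈p)

T-≟⇔ : ∀ {n} {x y : Fin n} → T ⌊ x ≟ y ⌋ ⇔ x ≡ y
T-≟⇔ {x = x} {y} = mk⇔ (toWitness {a? = x ≟ y}) (fromWitness {a? = x ≟ y})

T-not⇔¬T : ∀ {b} → T (not b) ⇔ (¬ T b)
T-not⇔¬T {true}  = mk⇔ (λ ()) (λ ¬t → ¬t tt)
T-not⇔¬T {false} = mk⇔ (λ _ ()) (λ _ → tt)

if-true : ∀ {b} {m : ℕ} → T b → (if b then m else 0) ≡ m
if-true {true} _ = refl

if-≢0 : ∀ {b} {m : ℕ} → (if b then m else 0) ≢ 0 → T b
if-≢0 {true}  _    = tt
if-≢0 {false} ≢0 = ≢0 refl

sumFin-suc : ∀ {n} (h : Fin (suc n) → ℕ) → sumFin h ≡ h zero + sumFin (h ∘ suc)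
sumFin-suc h = cong (λ xs → h zero + sum xs) (trans (map-tabulate suc h) (sym (map-tabulate id (h ∘ suc))))

sumFin≡0⇒ : ∀ {n} (h : Fin n → ℕ) → sumFin h ≡ 0 → ∀ x → h x ≡ 0
sumFin≡0⇒ h Σh≡0 zero    = m+n≡0⇒m≡0 (h zero) (trans (sym (sumFin-suc h)) Σh≡0)
sumFin≡0⇒ h Σh≡0 (suc x) = sumFin≡0⇒ (h ∘ suc) (m+n≡0⇒n≡0 (h zero) (trans (sym (sumFin-suc h)) Σh≡0)) x

sumFin≡1⇒ : ∀ {n} (h : Fin n → ℕ) → sumFin h ≡ 1 → ∃[ y ] (h y ≡ 1 × (∀ x → x ≢ y → h x ≡ 0))
sumFin≡1⇒ {suc n} h Σh≡1 with h zero in h0≡ | sumFin-suc h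
... | 0 | Σh≡Σtail with sumFin≡1⇒ (h ∘ suc) (trans (sym Σh≡Σtail) Σh≡1)
...   | y , hy≡1 , rest = suc y , hy≡1 , λ { zero _ → h0≡ ; (suc x) x≢y → rest x (x≢y ∘ cong suc) }
sumFin≡1⇒ {suc n} h Σh≡1 | 1 | Σh≡1+Σtail =
  zero , h0≡ , λ { zero 0≢0 → ⊥-elim (0≢0 refl)
                 ; (suc x) _ → sumFin≡0⇒ (h ∘ suc) (suc-injective (trans (sym Σh≡1+Σtail) Σh≡1)) x }
sumFin≡1⇒ {suc n} h Σh≡1 | suc (suc _) | Σh≡ = contradiction (trans (sym Σh≡) Σh≡1) λ ()

anyFin⁺ : ∀ {n} (p : Fin n → Bool) {x} → T (p x) → T (anyFin p)
anyFin⁺ p t = any⁺ p (Any.map (λ { refl → t }) (∈-allFin _))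

anyUpTo⁺ : ∀ k (p : ℕ → Bool) {i} → i ≤ k → T (p i) → T (anyUpTo k p)
anyUpTo⁺ zero    p z≤n t = t
anyUpTo⁺ (suc k) p i≤1+k t with m≤n⇒m<n∨m≡n i≤1+k
... | inj₁ i<1+k = from T-∨ (inj₁ (anyUpTo⁺ k p (≤-pred i<1+k) t))
... | inj₂ refl  = from T-∨ (inj₂ t)

anyUpTo⁻ : ∀ k (p : ℕ → Bool) → T (anyUpTo k p) → ∃[ i ] (i ≤ k × T (p i))
anyUpTo⁻ zero    p t = 0 , z≤n , t
anyUpTo⁻ (suc k) p t with to T-∨ t
... | inj₂ t′ = suc k , ≤-refl , t′
... | inj₁ t′ with anyUpTo⁻ k p t′
...   | i , i≤k , pi = i , m≤n⇒m≤1+n i≤k , pi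

anyBelow⁺ : ∀ k (p : ℕ → Bool) {i} → i < k → T (p i) → T (anyBelow k p)
anyBelow⁺ (suc k) p (s≤s i≤k) = anyUpTo⁺ k p i≤k

anyBelow⁻ : ∀ k (p : ℕ → Bool) → T (anyBelow k p) → ∃[ i ] (i < k × T (p i))
anyBelow⁻ (suc k) p t with anyUpTo⁻ k p t
... | i , i≤k , pi = i , s≤s i≤k , pi

module Walks {n : ℕ} (a : Fin n → Fin n → Bool) where

  _~_ : Fin n → Fin n → Set
  x ~ y = T (a x y)

  InjectiveOn : ℕ → (ℕ → Fin n) → Set
  InjectiveOn N u = ∀ {i j} → i ≤ N → j ≤ N → u i ≡ u j → i ≡ j

  Steps : ℕ → (ℕ → Fin n) → Set
  Steps N u = ∀ {i} → i < N → u i ~ u (suc i)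

  -- The cycle u 0 ~ u 1 ~ … ~ u N ~ u 0, of length N + 1.
  Cycle : ℕ → (ℕ → Fin n) → Set
  Cycle N u = InjectiveOn N u × Steps N u × u N ~ u 0

  record Path (N : ℕ) (x y : Fin n) : Set where
    field
      vertex    : ℕ → Fin n
      start     : vertex 0 ≡ x
      end       : vertex N ≡ y
      injective : InjectiveOn N vertex
      steps     : Steps N vertex

  Cycle⇒HasCycle : ∀ {N u} → Cycle N u → HasCycle a (suc N)
  Cycle⇒HasCycle {u = u} (inj , steps , closing) =
    u , (λ _ _ i<1+N j<1+N → inj (≤-pred i<1+N) (≤-pred j<1+N)) , (λ _ → steps ∘ ≤-pred) , closing

  HasCycle⇒Cycle : ∀ {N} → HasCycle a (suc N) → ∃ (Cycle N)
  HasCycle⇒Cycle (u , inj , steps , closing) =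
    u , (λ i≤N j≤N → inj _ _ (s≤s i≤N) (s≤s j≤N)) , (λ i<N → steps _ (s≤s i<N)) , closing

  snoc : ℕ → (ℕ → Fin n) → Fin n → ℕ → Fin n
  snoc N u b j = if does (j <? N) then u j else b

  snoc-< : ∀ {N} u b {j} → j < N → snoc N u b j ≡ u j
  snoc-< {N} u b {j} j<N rewrite dec-true (j <? N) j<N = refl

  snoc-N : ∀ N u b → snoc N u b N ≡ b
  snoc-N N u b rewrite dec-false (N <? N) (n≮n N) = refl

  close-path : ∀ {N u b} → 1 ≤ N → InjectiveOn N u → Steps N u →
               (∀ {i} → 1 ≤ i → i ≤ N → u i ≢ b) → u N ~ b → b ~ u 1 →
               Cycle N (snoc N (u ∘ suc) b)
  close-path {N} {u} {b} 1≤N inj steps b∉u uN~b b~u1 = injective , steps′ , closing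
    where
    w = snoc N (u ∘ suc) b
    w-< : ∀ {j} → j < N → w j ≡ u (suc j)
    w-< = snoc-< (u ∘ suc) b
    w-N : w N ≡ b
    w-N = snoc-N N (u ∘ suc) b
    injective : InjectiveOn N w
    injective i≤N j≤N wi≡wj with m≤n⇒m<n∨m≡n i≤N | m≤n⇒m<n∨m≡n j≤N
    ... | inj₁ i<N  | inj₁ j<N  = suc-injective (inj i<N j<N (trans (sym (w-< i<N)) (trans wi≡wj (w-< j<N))))
    ... | inj₁ i<N  | inj₂ refl = ⊥-elim (b∉u (s≤s z≤n) i<N (trans (sym (w-< i<N)) (trans wi≡wj w-N)))
    ... | inj₂ refl | inj₁ j<N  = ⊥-elim (b∉u (s≤s z≤n) j<N (trans (sym (w-< j<N)) (trans (sym wi≡wj) w-N)))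
    ... | inj₂ refl | inj₂ refl = refl
    steps′ : Steps N w
    steps′ {i} i<N with m≤n⇒m<n∨m≡n i<N
    ... | inj₁ 1+i<N = subst₂ _~_ (sym (w-< i<N)) (sym (w-< 1+i<N)) (steps 1+i<N)
    ... | inj₂ refl  = subst₂ _~_ (sym (w-< i<N)) (sym w-N) uN~b
    closing : w N ~ w 0
    closing = subst₂ _~_ (sym w-N) (sym (w-< 1≤N)) b~u1

  rotate : ∀ {N u} → 1 ≤ N → Cycle N u → Cycle N (snoc N (u ∘ suc) (u 0))
  rotate 1≤N (inj , steps , closing) =
    close-path 1≤N inj steps (λ 1≤i i≤N ui≡u0 → <⇒≢ 1≤i (sym (inj i≤N z≤n ui≡u0))) closing (steps 1≤N)

  rotate-to-end : ∀ (R : Fin n → Fin n → Set) {N u} i → i < N → Cycle N u → R (u i) (u (suc i)) →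
                  ∃[ w ] (Cycle N w × R (w N) (w 0))
  rotate-to-end R {N} {u} zero 0<N cyc r =
    _ , rotate 0<N cyc , subst₂ R (sym (snoc-N N (u ∘ suc) (u 0))) (sym (snoc-< (u ∘ suc) (u 0) 0<N)) r
  rotate-to-end R {N} {u} (suc i) 1+i<N cyc r =
    rotate-to-end R i i<N (rotate (≤-trans (s≤s z≤n) 1+i<N) cyc)
      (subst₂ R (sym (snoc-< (u ∘ suc) (u 0) i<N)) (sym (snoc-< (u ∘ suc) (u 0) 1+i<N)) r)
    where i<N = <-trans (n<1+n i) 1+i<N

  steps-or-gap : ∀ N u → Steps N u ⊎ ∃[ i ] (i < N × ¬ u i ~ u (suc i))
  steps-or-gap N u with anyUpTo? (λ i → ¬? (T? (a (u i) (u (suc i))))) N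
  ... | yes gap = inj₂ gap
  ... | no ¬gap = inj₁ λ {i} i<N → decidable-stable (T? _) (λ ¬step → ¬gap (i , i<N , ¬step))

  reverse : (∀ x y → a x y ≡ a y x) → ∀ {N x y} → Path N x y → Path N y x
  reverse a-sym {N} P = record
    { vertex    = λ j → vertex (N ∸ j)
    ; start     = end
    ; end       = trans (cong vertex (n∸n≡0 N)) start
    ; injective = λ {i} {j} i≤N j≤N eq → ∸-cancelˡ-≡ i≤N j≤N (injective (m∸n≤m N i) (m∸n≤m N j) eq)
    ; steps     = λ {j} j<N → let N∸j≡1+N∸1+j = +-∸-assoc 1 j<N in
        subst (λ k → vertex k ~ vertex (N ∸ suc j)) (sym N∸j≡1+N∸1+j)
          (subst T (a-sym _ _) (steps (subst (_≤ N) N∸j≡1+N∸1+j (m∸n≤m N j))))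
    }
    where open Path P

module _ {n : ℕ} {a : Fin n → Fin n → Bool} where
  open Walks a

  Joins : Fin n → Fin n → Fin n → Fin n → Set
  Joins x y p q = (p ≡ x × q ≡ y) ⊎ (p ≡ y × q ≡ x)

  new-edge : ∀ {x y p q} → T (addEdge a x y p q) → ¬ p ~ q → Joins x y p q
  new-edge pq⁺ ¬pq with to T-∨ pq⁺
  ... | inj₁ pq = contradiction pq ¬pq
  ... | inj₂ pq⁺ with to T-∨ pq⁺
  ...   | inj₁ p≡x∧q≡y = inj₁ (Product.map (to T-≟⇔) (to T-≟⇔) (to T-∧ p≡x∧q≡y))
  ...   | inj₂ p≡y∧q≡x = inj₂ (Product.map (to T-≟⇔) (to T-≟⇔) (to T-∧ p≡y∧q≡x))

  closing-edge-unique : ∀ {N u i x y} → 2 ≤ N → InjectiveOn N u → i < N →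
                        Joins x y (u N) (u 0) → Joins x y (u i) (u (suc i)) → ⊥
  closing-edge-unique {N} {u} {i} 2≤N inj i<N = clash
    where
    at-end : u i ≡ u N → ⊥
    at-end ui≡uN = <⇒≢ i<N (inj (<⇒≤ i<N) ≤-refl ui≡uN)
    wraps : u i ≡ u 0 → u (suc i) ≡ u N → ⊥
    wraps ui≡u0 ui+1≡uN =
      <⇒≢ 2≤N (trans (cong suc (sym (inj (<⇒≤ i<N) z≤n ui≡u0))) (inj {suc i} i<N ≤-refl ui+1≡uN))
    clash : Joins _ _ (u N) (u 0) → Joins _ _ (u i) (u (suc i)) → ⊥
    clash (inj₁ (uN≡x , u0≡y)) (inj₁ (ui≡x , _))         = at-end (trans ui≡x (sym uN≡x))
    clash (inj₁ (uN≡x , u0≡y)) (inj₂ (ui≡y , ui+1≡x))    = wraps (trans ui≡y (sym u0≡y)) (trans ui+1≡x (sym uN≡x))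
    clash (inj₂ (uN≡y , u0≡x)) (inj₁ (ui≡x , ui+1≡y))    = wraps (trans ui≡x (sym u0≡x)) (trans ui+1≡y (sym uN≡y))
    clash (inj₂ (uN≡y , u0≡x)) (inj₂ (ui≡y , _))         = at-end (trans ui≡y (sym uN≡y))

  saturating-cycle⇒path : (∀ x y → a x y ≡ a y x) → ∀ {N x y} → 2 ≤ N → ¬ HasCycle a (suc N) → ¬ x ~ y →
                          HasCycle (addEdge a x y) (suc N) → Path N x y
  saturating-cycle⇒path a-sym {N} {x} {y} 2≤N no-cycle ¬xy cycle⁺ = oriented (new-edge closing⁺ ¬closing)
    where
    module W⁺ = Walks (addEdge a x y)
    -- Rotate the cycle until its closing edge is the new edge xy; a cycle uses xy only once.
    closed-by-xy : ∃[ u ] (W⁺.Cycle N u × ¬ u N ~ u 0)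
    closed-by-xy with W⁺.HasCycle⇒Cycle cycle⁺
    ... | u , cyc with steps-or-gap N u
    ...   | inj₂ (i , i<N , gap) = W⁺.rotate-to-end (λ p q → ¬ p ~ q) i i<N cyc gap
    ...   | inj₁ steps with T? (a (u N) (u 0))
    ...     | yes closing = ⊥-elim (no-cycle (Cycle⇒HasCycle (proj₁ cyc , steps , closing)))
    ...     | no ¬closing = u , cyc , ¬closing
    u = proj₁ closed-by-xy
    inj = proj₁ (proj₁ (proj₂ closed-by-xy))
    steps⁺ = proj₁ (proj₂ (proj₁ (proj₂ closed-by-xy)))
    closing⁺ = proj₂ (proj₂ (proj₁ (proj₂ closed-by-xy)))
    ¬closing = proj₂ (proj₂ closed-by-xy)
    steps : Steps N u
    steps {i} i<N = decidable-stable (T? _) λ ¬step →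
      closing-edge-unique 2≤N inj i<N (new-edge closing⁺ ¬closing) (new-edge (steps⁺ i<N) ¬step)
    oriented : Joins x y (u N) (u 0) → Path N x y
    oriented (inj₂ (uN≡y , u0≡x)) =
      record { vertex = u ; start = u0≡x ; end = uN≡y ; injective = inj ; steps = steps }
    oriented (inj₁ (uN≡x , u0≡y)) = reverse a-sym
      (record { vertex = u ; start = u0≡y ; end = uN≡x ; injective = inj ; steps = steps })

module SimpleGraph {n : ℕ} (G : Graph n) where
  open Graph G
  open Walks adj using (_~_)
  -- deg does not depend on the second parameter of Construction.
  open Construction G 0 using (deg)

  ~-sym : ∀ {x y} → x ~ y → y ~ x
  ~-sym {x} {y} = subst T (adj-sym x y)

  ~-irrefl : ∀ {x} → ¬ x ~ x
  ~-irrefl {x} = subst T (adj-irr x)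

  -- Leaf p x : x is the only possible neighbour of p (p may be isolated).
  Leaf : Fin n → Fin n → Set
  Leaf p x = ∀ {z} → p ~ z → z ≡ x

  deg≡1⇔leaf : ∀ {x p} → x ~ p → deg x ≡ 1 ⇔ Leaf x p
  deg≡1⇔leaf x~p = mk⇔
    (λ deg≡1 {z} x~z → ∣p∣≡1⇒x≡y deg≡1 (from ∈-tabulate⇔ x~z) (from ∈-tabulate⇔ x~p))
    (λ leaf → ∣p∣≡1 (from ∈-tabulate⇔ x~p) (λ z∈N → leaf (to ∈-tabulate⇔ z∈N)))

module SaturatedGraph {n : ℕ} (G : Graph n) (ℓ : ℕ) (3≤ℓ : 3 ≤ ℓ) (sat : Saturated G ℓ) where
  open Graph G
  open Walks adj
  open SimpleGraph G

  N : ℕ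
  N = 2 * ℓ ∸ 1

  1+N≡2ℓ : suc N ≡ 2 * ℓ
  1+N≡2ℓ = m+[n∸m]≡n (≤-trans (s≤s z≤n) (*-monoʳ-≤ 2 3≤ℓ))

  4≤N : 4 ≤ N
  4≤N = ≤-trans (n≤1+n 4) (∸-monoˡ-≤ 1 (*-monoʳ-≤ 2 3≤ℓ))

  ≤4⇒≤N : ∀ {k} → k ≤ 4 → k ≤ N
  ≤4⇒≤N k≤4 = ≤-trans k≤4 4≤N

  no-cycle : ∀ {u} → ¬ Cycle N u
  no-cycle cyc = proj₁ sat (subst (HasCycle adj) 1+N≡2ℓ (Cycle⇒HasCycle cyc))

  saturating-path : ∀ {x y} → x ≢ y → ¬ x ~ y → Path N x y
  saturating-path {x} {y} x≢y ¬xy = saturating-cycle⇒path adj-sym (≤4⇒≤N (s≤s (s≤s z≤n)))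
    (proj₁ sat ∘ subst (HasCycle adj) 1+N≡2ℓ) ¬xy
    (subst (HasCycle (addEdge adj x y)) (sym 1+N≡2ℓ) (proj₂ sat x y x≢y (¬-not (¬xy ∘ from T-≡))))

  leaf-start : ∀ {p x y} (P : Path N p y) → Leaf p x → Path.vertex P 1 ≡ x
  leaf-start P p-leaf = p-leaf (subst (_~ vertex 1) start (steps (≤4⇒≤N (s≤s z≤n))))
    where open Path P

  leaf-not-interior : ∀ {x y q i} (P : Path N x y) → 1 ≤ i → i < N → ¬ Leaf (Path.vertex P i) q
  leaf-not-interior {i = suc i} P _ 1+i<N leaf =
    <⇒≢ (m<n⇒m<1+n (n<1+n i)) (injective (≤-trans (n≤1+n i) (<⇒≤ 1+i<N)) 1+i<N
      (trans (leaf (~-sym (steps (<-trans (n<1+n i) 1+i<N)))) (sym (leaf (steps 1+i<N)))))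
    where open Path P

  -- If p ≢ q, x would be both the second and the penultimate vertex of a saturating path from p to q.
  leaves-coincide : ∀ {p q x} → q ~ x → Leaf p x → Leaf q x → p ≡ q
  leaves-coincide {p} {q} {x} q~x p-leaf q-leaf with p ≟ q
  ... | yes p≡q = p≡q
  ... | no p≢q = contradiction
    (injective (≤4⇒≤N (s≤s z≤n)) (m∸n≤m N 1)
      (trans (leaf-start P p-leaf) (sym (leaf-start (reverse adj-sym P) q-leaf))))
    (<⇒≢ (≤-trans (s≤s (s≤s z≤n)) (∸-monoˡ-≤ 1 4≤N)))
    where
    P = saturating-path p≢q (λ p~q → ~-irrefl (subst (_~ x) (p-leaf p~q) q~x))
    open Path P

  -- A saturating path from a leaf z ≢ p at x to p starts z, x; its third vertex, a neighbour
  -- of x, can be neither p (the path is too long) nor a leaf at x (it is interior).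
  leaf-of-leaves : ∀ {x p} → x ~ p → (∀ {z} → x ~ z → z ≢ p → Leaf z x) → Leaf x p
  leaf-of-leaves {x} {p} x~p others-leaves {z} x~z with z ≟ p
  ... | yes z≡p = z≡p
  ... | no z≢p = third-vertex (vertex 2 ≟ p)
    where
    z-leaf = others-leaves x~z z≢p
    P = saturating-path z≢p (λ z~p → ~-irrefl (subst (x ~_) (z-leaf z~p) x~p))
    open Path P
    2<N : 2 < N
    2<N = ≤4⇒≤N (s≤s (s≤s (s≤s z≤n)))
    x~u2 : x ~ vertex 2
    x~u2 = subst (_~ vertex 2) (leaf-start P z-leaf) (steps (<-trans (n<1+n 1) 2<N))
    third-vertex : Dec (vertex 2 ≡ p) → z ≡ p
    third-vertex (yes u2≡p) = contradiction (injective (<⇒≤ 2<N) ≤-refl (trans u2≡p (sym end))) (<⇒≢ 2<N)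
    third-vertex (no u2≢p)  = ⊥-elim (leaf-not-interior P (s≤s z≤n) 2<N (others-leaves x~u2 u2≢p))

  -- A saturating path from w to c starts w, a and never meets b, so appending b closes a 2ℓ-cycle.
  hub-neighbour-has-no-leaf : ∀ {a b c w} → a ~ b → b ~ c → a ≢ c →
                              (∀ {z} → b ~ z → z ≡ a ⊎ z ≡ c ⊎ Leaf z b) → ¬ Leaf w a
  hub-neighbour-has-no-leaf {a} {b} {c} {w} a~b b~c a≢c b-nbrs w-leaf =
    no-cycle (close-path 1≤N injective steps b∉P (subst (_~ b) (sym end) (~-sym b~c)) (subst (b ~_) (sym u1≡a) (~-sym a~b)))
    where
    1≤N = ≤4⇒≤N (s≤s z≤n)
    P : Path N w c
    P = saturating-path (λ w≡c → ~-irrefl (subst (a ~_) (w-leaf (subst (_~ b) (sym w≡c) (~-sym b~c))) a~b))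
             (λ w~c → a≢c (sym (w-leaf w~c)))
    open Path P
    u1≡a = leaf-start P w-leaf
    interior-neighbour : ∀ {s} → 1 ≤ s → s < N → b ~ vertex s → s ≡ 1
    interior-neighbour {s} 1≤s s<N b~us = classify (b-nbrs b~us)
      where
      classify : vertex s ≡ a ⊎ vertex s ≡ c ⊎ Leaf (vertex s) b → s ≡ 1
      classify (inj₁ us≡a)        = injective (<⇒≤ s<N) 1≤N (trans us≡a (sym u1≡a))
      classify (inj₂ (inj₁ us≡c)) = contradiction (injective (<⇒≤ s<N) ≤-refl (trans us≡c (sym end))) (<⇒≢ s<N)
      classify (inj₂ (inj₂ leaf)) = ⊥-elim (leaf-not-interior P 1≤s s<N leaf)
    b∉P : ∀ {t} → 1 ≤ t → t ≤ N → vertex t ≢ b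
    b∉P {suc t} _ 1+t≤N ut≡b = last-or-interior (m≤n⇒m<n∨m≡n 1+t≤N)
      where
      before-last : suc t < N → suc (suc t) < N ⊎ suc (suc t) ≡ N → ⊥
      before-last 1+t<N (inj₁ 2+t<N) =
        1+n≢0 (suc-injective (interior-neighbour (s≤s z≤n) 2+t<N (subst (_~ vertex (suc (suc t))) ut≡b (steps 1+t<N))))
      before-last 1+t<N (inj₂ 2+t≡N) =
        <⇒≢ 2≤t (sym (interior-neighbour (≤-trans (s≤s z≤n) 2≤t) (<⇒≤ 1+t<N)
                                         (~-sym (subst (vertex t ~_) ut≡b (steps (<⇒≤ 1+t<N))))))
        where
        2≤t : 2 ≤ t
        2≤t = ≤-pred (≤-pred (subst (4 ≤_) (sym 2+t≡N) 4≤N))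
      last-or-interior : suc t < N ⊎ suc t ≡ N → ⊥
      last-or-interior (inj₁ 1+t<N) = before-last 1+t<N (m≤n⇒m<n∨m≡n 1+t<N)
      last-or-interior (inj₂ 1+t≡N) = ~-irrefl (subst (b ~_) (trans (sym end) (trans (cong vertex (sym 1+t≡N)) ut≡b)) b~c)

iter-+ : ∀ {A : Set} (f : A → A) i j x → iter f (i + j) x ≡ iter f i (iter f j x)
iter-+ f zero    j x = refl
iter-+ f (suc i) j x = cong f (iter-+ f i j x)

iter-suc : ∀ {A : Set} (f : A → A) j x → iter f (suc j) x ≡ iter f j (f x)
iter-suc f zero    x = refl
iter-suc f (suc j) x = cong f (iter-suc f j x)

module Forest {n : ℕ} (G : Graph n) (ℓ : ℕ) (S : Subset n) (par : Fin n → Fin n)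
              (valid : Construction.WithS.ValidParent G ℓ S par) where
  open Graph G
  open Walks adj using (_~_)
  open SimpleGraph G using (~-sym)
  open Construction G ℓ using (ball; nbhd)
  open Construction.WithS G ℓ S
  open Construction.WithS.WithPar G ℓ S par

  ∉-lookup : ∀ {p : Subset n} {x} → T (not (lookup p x)) → x ∉ p
  ∉-lookup ¬x∈p = to T-not⇔¬T ¬x∈p ∘ to ∈⇔T-lookup

  layer⇒∉MAB : ∀ {i x} → x ∈ layer i → x ∉ MAB
  layer⇒∉MAB {zero}  x∈ = ∉-lookup (proj₁ (to T-∧ (to ∈-tabulate⇔ x∈)))
  layer⇒∉MAB {suc i} x∈ = ∉-lookup (proj₁ (to T-∧ (to ∈-tabulate⇔ x∈))) ∘ p⊆p∪q D₀

  layer⇒∉B : ∀ {i x} → x ∈ layer i → x ∉ Bset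
  layer⇒∉B {i} x∈ = layer⇒∉MAB {i} x∈ ∘ q⊆p∪q Mset (Aset ∪ Bset) ∘ q⊆p∪q Aset Bset

  layer⇒∉M : ∀ {i x} → x ∈ layer i → x ∉ Mset
  layer⇒∉M {i} x∈ = layer⇒∉MAB {i} x∈ ∘ p⊆p∪q (Aset ∪ Bset)

  layer-suc⁻ : ∀ {i x} → x ∈ layer (suc i) → x ∉ D₀ × x ∈ ball BD₀ (suc i) × x ∉ ball BD₀ i
  layer-suc⁻ x∈ with to T-∧ (to ∈-tabulate⇔ x∈)
  ... | ¬x∈MAB∪D₀ , rest with to T-∧ rest
  ...   | x∈ball , x∉ball = ∉-lookup ¬x∈MAB∪D₀ ∘ q⊆p∪q MAB D₀ , from ∈⇔T-lookup x∈ball , ∉-lookup x∉ball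

  ball-mono : ∀ {X : Subset n} {i j} → i ≤ j → ball X i ⊆ ball X j
  ball-mono {j = zero} z≤n = id
  ball-mono {X} {j = suc j} i≤1+j with m≤n⇒m<n∨m≡n i≤1+j
  ... | inj₁ i<1+j = p⊆p∪q (nbhd (ball X j)) ∘ ball-mono (≤-pred i<1+j)
  ... | inj₂ refl  = id

  ball-step : ∀ {X : Subset n} {i x y} → x ∈ ball X i → x ~ y → y ∈ ball X (suc i)
  ball-step {X} {i} {x} {y} x∈ x~y = q⊆p∪q (ball X i) _ (from ∈-tabulate⇔
    (anyFin⁺ (λ z → lookup (ball X i) z ∧ adj z y) {x} (from T-∧ (to ∈⇔T-lookup x∈ , x~y))))

  layer-unique : ∀ {i j x} → x ∈ layer i → x ∈ layer j → i ≡ j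
  layer-unique {zero}  {zero}  _  _  = refl
  layer-unique {zero}  {suc j} x∈ x∈′ = ⊥-elim (proj₁ (layer-suc⁻ {j} x∈′) x∈)
  layer-unique {suc i} {zero}  x∈ x∈′ = ⊥-elim (proj₁ (layer-suc⁻ {i} x∈) x∈′)
  layer-unique {suc i} {suc j} x∈ x∈′ with layer-suc⁻ {i} x∈ | layer-suc⁻ {j} x∈′ | <-cmp i j
  ... | _ | _ | tri≈ _ i≡j _ = cong suc i≡j
  ... | _ , x∈ball , _ | _ , _ , x∉ball | tri< i<j _ _ = ⊥-elim (x∉ball (ball-mono i<j x∈ball))
  ... | _ , _ , x∉ball | _ , x∈ball , _ | tri> _ _ j<i = ⊥-elim (x∉ball (ball-mono j<i x∈ball))

  -- x ∈ D_i with i ≤ ℓ - 2; a record, so that i can be inferred.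
  record _∈D[_] (x : Fin n) (i : ℕ) : Set where
    constructor in-layer
    field
      bounded : i ≤ ℓ ∸ 2
      member  : x ∈ layer i

  parent-adj : ∀ {i x} → x ∈D[ i ] → x ~ par x
  parent-adj (in-layer i≤ x∈) = proj₁ (valid _ _ i≤ x∈)

  child-layer : ∀ {i j x z} → z ∈D[ j ] → x ∈ layer i → par z ≡ x → j ≡ suc i
  child-layer {i} {j} {x} (in-layer j≤ z∈) x∈ par-z≡x =
    below j (x∈p∪q⁻ Bset (prevLayer j) (subst (_∈ Bset ∪ prevLayer j) par-z≡x (proj₂ (valid _ _ j≤ z∈))))
    where
    below : ∀ j → x ∈ Bset ⊎ x ∈ prevLayer j → j ≡ suc i
    below _       (inj₁ x∈B)    = ⊥-elim (layer⇒∉B {i} x∈ x∈B)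
    below zero    (inj₂ x∈M)    = ⊥-elim (layer⇒∉M {i} x∈ x∈M)
    below (suc j) (inj₂ x∈prev) = cong suc (layer-unique x∈prev x∈)

  parent-layer : ∀ {i x} → x ∈D[ suc (suc i) ] → par x ∈D[ suc i ]
  parent-layer {i} {x} x∈D@(in-layer i≤ x∈) =
    in-layer (≤-trans (n≤1+n _) i≤) (not-in-B (x∈p∪q⁻ Bset _ (proj₂ (valid _ _ i≤ x∈))))
    where
    -- x is at distance i + 2 ≥ 2 from B ∪ D₀, so its neighbour par x is not in B.
    not-in-B : par x ∈ Bset ⊎ par x ∈ layer (suc i) → par x ∈ layer (suc i)
    not-in-B (inj₂ par-x∈) = par-x∈
    not-in-B (inj₁ par-x∈B) = ⊥-elim (proj₂ (proj₂ (layer-suc⁻ {suc i} x∈))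
      (ball-mono {BD₀} {1} {suc i} (s≤s z≤n) (ball-step {BD₀} {0} (p⊆p∪q D₀ par-x∈B) (~-sym (parent-adj x∈D)))))

  grandparent-≢ : ∀ {i j x} → x ∈D[ i ] → par x ∈D[ j ] → x ≢ par (par x)
  grandparent-≢ {i} {j} x∈D par-x∈D x≡ppx = <⇒≢ (m<n⇒m<1+n (n<1+n i)) (trans i≡1+j (cong suc j≡1+i))
    where
    i≡1+j = child-layer x∈D (_∈D[_].member par-x∈D) refl
    j≡1+i = child-layer par-x∈D (_∈D[_].member x∈D) (sym x≡ppx)

  iter-layer : ∀ j {m x} → 1 ≤ m → x ∈D[ j + m ] → iter par j x ∈D[ m ]
  iter-layer zero    _ x∈D = x∈D
  iter-layer (suc j) {suc m} {x} _ x∈D =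
    parent-layer (iter-layer j (s≤s z≤n) (subst (x ∈D[_]) (sym (+-suc j (suc m))) x∈D))

  ∈D-unique : ∀ {i j x} → x ∈D[ i ] → x ∈D[ j ] → i ≡ j
  ∈D-unique x∈Di x∈Dj = layer-unique (_∈D[_].member x∈Di) (_∈D[_].member x∈Dj)

  inD₀₊⁻ : ∀ {x} → T (inD₀₊ x) → ∃[ i ] x ∈D[ i ]
  inD₀₊⁻ {x} t with anyUpTo⁻ (ℓ ∸ 2) (λ i → lookup (layer i) x) t
  ... | i , i≤ , x∈ = i , in-layer i≤ (from ∈⇔T-lookup x∈)

  inD₀₊⁺ : ∀ {i x} → x ∈D[ i ] → T (inD₀₊ x)
  inD₀₊⁺ {x = x} (in-layer i≤ x∈) = anyUpTo⁺ (ℓ ∸ 2) (λ i → lookup (layer i) x) i≤ (to ∈⇔T-lookup x∈)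

  inD⁻ : ∀ {x} → T (inD x) → ∃[ i ] (1 ≤ i × x ∈D[ i ])
  inD⁻ {x} t with anyUpTo⁻ (ℓ ∸ 2) (λ i → not (i ≡ᵇ 0) ∧ lookup (layer i) x) t
  ... | suc i , i≤ , x∈ = suc i , s≤s z≤n , in-layer i≤ (from ∈⇔T-lookup x∈)

  -- x ∈ V(T_v): x lies depth steps below v along black edges, and v lies in D_level.
  record _∈T_ (x v : Fin n) : Set where
    constructor descends
    field
      {depth level} : ℕ
      1≤level : 1 ≤ level
      x∈D     : x ∈D[ depth + level ]
      reaches : iter par depth x ≡ v

  root∈D : ∀ {x v} (x∈Tv : x ∈T v) → v ∈D[ _∈T_.level x∈Tv ]
  root∈D (descends {j} 1≤m x∈D reaches) = subst (_∈D[ _ ]) reaches (iter-layer j 1≤m x∈D)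

  ∈T-root : ∀ {i v} → 1 ≤ i → v ∈D[ i ] → v ∈T v
  ∈T-root 1≤i v∈D = descends {depth = 0} 1≤i v∈D refl

  ∈T⇒∈D : ∀ {x v} → x ∈T v → ∃[ i ] (1 ≤ i × x ∈D[ i ])
  ∈T⇒∈D (descends {j} {m} 1≤m x∈D _) = j + m , ≤-trans 1≤m (m≤n+m m j) , x∈D

  ∈T-trans : ∀ {z x v} → z ∈T x → x ∈T v → z ∈T v
  ∈T-trans {z} z∈Tx@(descends {j₂} {m₂} _ z∈D z↑x) (descends {j₁} {m₁} 1≤m₁ x∈D x↑v) =
    descends {depth = j₁ + j₂} 1≤m₁ (subst (z ∈D[_]) levels z∈D)
      (trans (iter-+ par j₁ j₂ z) (trans (cong (iter par j₁) z↑x) x↑v))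
    where
    open ≡-Reasoning
    levels : j₂ + m₂ ≡ (j₁ + j₂) + m₁
    levels = begin
      j₂ + m₂          ≡⟨ cong (j₂ +_) (∈D-unique (root∈D z∈Tx) x∈D) ⟩
      j₂ + (j₁ + m₁)   ≡⟨ sym (+-assoc j₂ j₁ m₁) ⟩
      (j₂ + j₁) + m₁   ≡⟨ cong (_+ m₁) (+-comm j₂ j₁) ⟩
      (j₁ + j₂) + m₁   ∎

  ∈T-parent : ∀ {x v} → x ∈T v → x ≢ v → par x ∈T v
  ∈T-parent (descends {zero} _ _ x≡v) x≢v = contradiction x≡v x≢v
  ∈T-parent {x} (descends {suc j} {m} 1≤m x∈D reaches) _ =
    descends 1≤m (iter-layer 1 (≤-trans 1≤m (m≤n+m m j)) x∈D) (trans (sym (iter-suc par j x)) reaches)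

  ParentEdge : Fin n → Fin n → Set
  ParentEdge x y = T (inD₀₊ x) × par x ≡ y

  child∈D : ∀ {i x z} → x ∈D[ i ] → ParentEdge z x → z ∈D[ suc i ]
  child∈D {i} {z = z} x∈D (z∈D₀₊ , par-z≡x) =
    subst (z ∈D[_]) (child-layer {i} z∈D (_∈D[_].member x∈D) par-z≡x) z∈D
    where z∈D = proj₂ (inD₀₊⁻ z∈D₀₊)

  ∈T-child : ∀ {x z v} → x ∈T v → ParentEdge z x → z ∈T v
  ∈T-child {z = z} (descends {j} 1≤m x∈D reaches) z↑x@(_ , par-z≡x) =
    descends {depth = suc j} 1≤m (child∈D x∈D z↑x) (trans (iter-suc par j z) (trans (cong (iter par j) par-z≡x) reaches))

  ∈VT⇔∈T : ∀ {x v} → x ∈ VT v ⇔ x ∈T v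
  ∈VT⇔∈T {x} {v} = mk⇔ from-VT to-VT
    where
    below : ℕ → Bool
    below i = anyBelow i (λ j → ⌊ iter par j x ≟ v ⌋)
    from-VT : x ∈ VT v → x ∈T v
    from-VT x∈VT with anyUpTo⁻ (ℓ ∸ 2) (λ i → not (i ≡ᵇ 0) ∧ lookup (layer i) x ∧ below i)
                        (proj₂ (to T-∧ (to ∈-tabulate⇔ x∈VT)))
    ... | suc i , i≤ , t with to T-∧ t
    ...   | x∈ , t′ with anyBelow⁻ (suc i) (λ j → ⌊ iter par j x ≟ v ⌋) t′
    ...     | j , j<1+i , reaches =
      descends (m<n⇒0<n∸m j<1+i)
               (subst (x ∈D[_]) (sym (m+[n∸m]≡n (<⇒≤ j<1+i))) (in-layer i≤ (from ∈⇔T-lookup x∈)))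
               (to T-≟⇔ reaches)
    to-VT : x ∈T v → x ∈ VT v
    to-VT (descends {j} {m} 1≤m (in-layer i≤ x∈) reaches) =
      from ∈-tabulate⇔ (at-level (j + m) (≤-trans 1≤m (m≤n+m m j)) i≤ x∈ (m<m+n j 1≤m))
      where
      at-level : ∀ i → 1 ≤ i → i ≤ ℓ ∸ 2 → x ∈ layer i → j < i → T (inD x ∧ inP x v)
      at-level (suc i) _ i≤ x∈ j<i = from T-∧
        ( anyUpTo⁺ (ℓ ∸ 2) (λ i → not (i ≡ᵇ 0) ∧ lookup (layer i) x) i≤ (to ∈⇔T-lookup x∈)
        , anyUpTo⁺ (ℓ ∸ 2) (λ i → not (i ≡ᵇ 0) ∧ lookup (layer i) x ∧ below i) i≤
            (from T-∧ (to ∈⇔T-lookup x∈ , anyBelow⁺ (suc i) _ j<i (from T-≟⇔ reaches))))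

  ∈T⇒∈D₀₊ : ∀ {x v} → x ∈T v → T (inD₀₊ x)
  ∈T⇒∈D₀₊ x∈Tv = inD₀₊⁺ (proj₂ (proj₂ (∈T⇒∈D x∈Tv)))

  ∈T⇒parent-adj : ∀ {x v} → x ∈T v → x ~ par x
  ∈T⇒parent-adj x∈Tv = parent-adj (proj₂ (proj₂ (∈T⇒∈D x∈Tv)))

  black⇔ : ∀ {x y} → T (black x y) ⇔ (ParentEdge x y ⊎ ParentEdge y x)
  black⇔ = mk⇔ (Sum.map parent-edge⁻ parent-edge⁻ ∘ to T-∨)
               (from T-∨ ∘ Sum.map parent-edge⁺ parent-edge⁺)
    where
    parent-edge⁻ : ∀ {x y} → T (inD₀₊ x ∧ ⌊ par x ≟ y ⌋) → ParentEdge x y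
    parent-edge⁻ t = Product.map₂ (to T-≟⇔) (to T-∧ t)
    parent-edge⁺ : ∀ {x y} → ParentEdge x y → T (inD₀₊ x ∧ ⌊ par x ≟ y ⌋)
    parent-edge⁺ (x∈D₀₊ , par-x≡y) = from T-∧ (x∈D₀₊ , from T-≟⇔ par-x≡y)

  gray⇔ : ∀ {x y} → T (gray x y) ⇔ (x ~ y × ¬ T (black x y))
  gray⇔ = mk⇔ (Product.map₂ (to T-not⇔¬T) ∘ to T-∧)
              (from T-∧ ∘ Product.map₂ (from T-not⇔¬T))

  gray⇒g≢0 : ∀ {x y} → T (gray x y) → g x ≢ 0
  gray⇒g≢0 {x} xy-gray g≡0 = ∣p∣≡0⇒x∉p {p = tabulate (gray x)} g≡0 (from ∈-tabulate⇔ xy-gray)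

  g≡0⇒parent-or-child : ∀ {x z} → g x ≡ 0 → x ~ z → z ≡ par x ⊎ ParentEdge z x
  g≡0⇒parent-or-child {x} {z} g≡0 x~z = Sum.map₁ (sym ∘ proj₂) (to black⇔ xz-black)
    where
    xz-black = decidable-stable (T? (black x z)) λ ¬black → gray⇒g≢0 (from gray⇔ (x~z , ¬black)) g≡0

  gT≡0⇒ : ∀ {v x} → gT v ≡ 0 → x ∈T v → g x ≡ 0
  gT≡0⇒ {v} {x} gT≡0 x∈Tv =
    trans (sym (if-true (to ∈⇔T-lookup (from ∈VT⇔∈T x∈Tv)))) (sumFin≡0⇒ _ gT≡0 x)

  gT≡1⇒ : ∀ {v} → gT v ≡ 1 → ∃[ y ] (y ∈T v × (∀ {x} → x ∈T v → x ≢ y → g x ≡ 0))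
  gT≡1⇒ {v} gT≡1 with sumFin≡1⇒ _ gT≡1
  ... | y , term-y≡1 , others≡0 =
    y , to ∈VT⇔∈T (from ∈⇔T-lookup (if-≢0 (1+n≢0 ∘ trans (sym term-y≡1))))
      , λ {x} x∈Tv x≢y → trans (sym (if-true (to ∈⇔T-lookup (from ∈VT⇔∈T x∈Tv)))) (others≡0 x x≢y)

module TreeShape {n : ℕ} (G : Graph n) (ℓ : ℕ) (3≤ℓ : 3 ≤ ℓ) (sat : Saturated G ℓ) (S : Subset n)
             (par : Fin n → Fin n) (valid : Construction.WithS.ValidParent G ℓ S par) where
  open Graph G
  open Walks adj
  open SimpleGraph G
  open SaturatedGraph G ℓ 3≤ℓ sat
  open Forest G ℓ S par valid
  open Construction G ℓ using (deg)
  open Construction.WithS G ℓ S using (inD)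
  open Construction.WithS.WithPar G ℓ S par

  gray-free-subtree⇒leaf : ∀ {i x} → 1 ≤ i → x ∈D[ i ] → (∀ {z} → z ∈T x → g z ≡ 0) → Leaf x (par x)
  gray-free-subtree⇒leaf {i} = go (ℓ ∸ 2) (m≤n+m (ℓ ∸ 2) i)
    where
    go : ∀ d {i x} → ℓ ∸ 2 ≤ i + d → 1 ≤ i → x ∈D[ i ] → (∀ {z} → z ∈T x → g z ≡ 0) → Leaf x (par x)
    go d {i} {x} height 1≤i x∈D gray-free = leaf-of-leaves (parent-adj x∈D) λ x~z z≢par-x →
      Sum.[ flip contradiction z≢par-x , child-is-leaf d height ]′ (g≡0⇒parent-or-child (gray-free x∈Tx) x~z)
      where
      x∈Tx = ∈T-root 1≤i x∈D
      child-is-leaf : ∀ d → ℓ ∸ 2 ≤ i + d → ∀ {z} → ParentEdge z x → Leaf z x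
      child-is-leaf zero     height′ z↑x =
        contradiction (≤-trans (_∈D[_].bounded (child∈D x∈D z↑x)) (subst (ℓ ∸ 2 ≤_) (+-identityʳ i) height′))
                      (n≮n i)
      child-is-leaf (suc d′) height′ z↑x = subst (Leaf _) (proj₂ z↑x)
        (go d′ (subst (ℓ ∸ 2 ≤_) (+-suc i d′) height′) (s≤s z≤n) (child∈D x∈D z↑x)
            (λ w∈Tz → gray-free (∈T-trans w∈Tz (∈T-child x∈Tx z↑x))))

  part-i : ∀ {v} → T (inD v) → gT v ≡ 0 → deg v ≡ 1
  part-i v∈D gT≡0 with inD⁻ v∈D
  ... | _ , 1≤i , v∈Di = from (deg≡1⇔leaf (parent-adj v∈Di)) (gray-free-subtree⇒leaf 1≤i v∈Di (gT≡0⇒ gT≡0))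

  gray-at-degree-one-impossible : ∀ {x v z} → x ∈T v → deg x ≡ 1 → ¬ T (gray x z)
  gray-at-degree-one-impossible {x} x∈Tv deg≡1 xz-gray = proj₂ (to gray⇔ xz-gray)
    (from black⇔ (inj₁ (∈T⇒∈D₀₊ x∈Tv , sym z≡par-x)))
    where
    z≡par-x = to (deg≡1⇔leaf (∈T⇒parent-adj x∈Tv)) deg≡1 (proj₁ (to gray⇔ xz-gray))

  TinyTree : Fin n → Set
  TinyTree v = (∀ z → z ∈ VT v ⇔ z ≡ v) ⊎ (∃[ w ] (w ≢ v × deg w ≡ 1 × (∀ z → z ∈ VT v ⇔ (z ≡ v ⊎ z ≡ w))))

  tiny-tree⇒gray-at-root : ∀ {v x z} → x ∈ VT v → T (gray x z) → TinyTree v → x ≡ v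
  tiny-tree⇒gray-at-root x∈VT xz-gray (inj₁ only-v) = to (only-v _) x∈VT
  tiny-tree⇒gray-at-root {x = x} x∈VT xz-gray (inj₂ (w , _ , deg-w≡1 , only-v-w)) =
    Sum.[ id , (λ x≡w → contradiction xz-gray (gray-at-degree-one-impossible (to ∈VT⇔∈T x∈VT)
                                                      (subst (λ t → deg t ≡ 1) (sym x≡w) deg-w≡1))) ]′
      (to (only-v-w x) x∈VT)

  -- y carries every gray half-edge of T_v; s 0 = y, s 1, …, s k = v is its black path up to v.
  module Spine {v y : Fin n} (y∈Tv : y ∈T v) (gray-free : ∀ {x} → x ∈T v → x ≢ y → g x ≡ 0) where
    open _∈T_ y∈Tv renaming (depth to k; level to m; 1≤level to 1≤m; x∈D to y∈D; reaches to y↑v)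

    s : ℕ → Fin n
    s i = iter par i y

    OnSpine : Fin n → Set
    OnSpine x = ∃[ i ] (i ≤ k × s i ≡ x)

    on-spine? : ∀ x → Dec (OnSpine x)
    on-spine? x = map′ (λ (i , i<1+k , si≡x) → i , ≤-pred i<1+k , si≡x) (λ (i , i≤k , si≡x) → i , s≤s i≤k , si≡x)
                       (anyUpTo? (λ i → s i ≟ x) (suc k))

    v-on-spine : OnSpine v
    v-on-spine = k , ≤-refl , y↑v

    spine∈D : ∀ {i} → i ≤ k → s i ∈D[ (k ∸ i) + m ]
    spine∈D {i} i≤k = iter-layer i (≤-trans 1≤m (m≤n+m m (k ∸ i))) (subst (y ∈D[_]) (sym levels) y∈D)
      where
      levels : i + ((k ∸ i) + m) ≡ k + m
      levels = trans (sym (+-assoc i (k ∸ i) m)) (cong (_+ m) (m+[n∸m]≡n i≤k))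

    spine∈T : ∀ {i} → i ≤ k → s i ∈T v
    spine∈T {i} i≤k = descends {depth = k ∸ i} 1≤m (spine∈D i≤k)
      (trans (sym (iter-+ par (k ∸ i) i y)) (trans (cong (λ j → iter par j y) (m∸n+n≡m i≤k)) y↑v))

    spine-injective : InjectiveOn k s
    spine-injective {i} {j} i≤k j≤k si≡sj = ∸-cancelˡ-≡ i≤k j≤k
      (+-cancelʳ-≡ m _ _ (∈D-unique (spine∈D i≤k) (subst (_∈D[ (k ∸ j) + m ]) (sym si≡sj) (spine∈D j≤k))))

    ancestor-on-spine : ∀ {x} → x ∈T v → y ∈T x → OnSpine x
    ancestor-on-spine x∈Tv@(descends {j′} {m′} _ x∈D _) y∈Tx@(descends {j} {l} _ y∈D′ y↑x) =
      j , subst (j ≤_) (+-cancelʳ-≡ m _ _ levels) (m≤m+n j j′) , y↑x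
      where
      open ≡-Reasoning
      levels : (j + j′) + m ≡ k + m
      levels = begin
        (j + j′) + m   ≡⟨ +-assoc j j′ m ⟩
        j + (j′ + m)   ≡⟨ cong (λ t → j + (j′ + t)) (∈D-unique (root∈D y∈Tv) (root∈D x∈Tv)) ⟩
        j + (j′ + m′)  ≡⟨ cong (j +_) (∈D-unique x∈D (root∈D y∈Tx)) ⟩
        j + l          ≡⟨ ∈D-unique y∈D′ y∈D ⟩
        k + m          ∎

    parent-along-spine : ∀ {i j} → i ≤ k → j ≤ k → par (s i) ≡ s j → j ≡ suc i
    parent-along-spine {i} {j} i≤k j≤k par-si≡sj = Sum.[ below-root , at-root ]′ (m≤n⇒m<n∨m≡n i≤k)
      where
      below-root : i < k → j ≡ suc i
      below-root i<k = sym (spine-injective i<k j≤k par-si≡sj)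
      at-root : i ≡ k → j ≡ suc i
      at-root refl = contradiction
        (child-layer (root∈D y∈Tv) (_∈D[_].member (spine∈D j≤k)) (trans (cong par (sym y↑v)) par-si≡sj))
        (<⇒≢ (s≤s (m≤n+m m (k ∸ j))))

    spine-child : ∀ {i z} → i < k → ParentEdge z (s (suc i)) → OnSpine z → z ≡ s i
    spine-child {i} i<k (_ , par-z≡si+1) (i′ , i′≤k , si′≡z) =
      trans (sym si′≡z)
            (cong s (suc-injective (sym (parent-along-spine i′≤k i<k (trans (cong par si′≡z) par-z≡si+1)))))

    gray⇒≡y : ∀ {x z} → x ∈T v → T (gray x z) → x ≡ y
    gray⇒≡y {x} x∈Tv xz-gray = decidable-stable (x ≟ y) (gray⇒g≢0 xz-gray ∘ gray-free x∈Tv)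

    off-spine-leaf : ∀ {x} → x ∈T v → ¬ OnSpine x → Leaf x (par x)
    off-spine-leaf x∈Tv x-off with ∈T⇒∈D x∈Tv
    ... | _ , 1≤i , x∈D = gray-free-subtree⇒leaf 1≤i x∈D λ z∈Tx →
      gray-free (∈T-trans z∈Tx x∈Tv) (λ z≡y → x-off (ancestor-on-spine x∈Tv (subst (_∈T _) z≡y z∈Tx)))

    off-spine-child-of-root : ∀ {x} → x ∈T v → ¬ OnSpine x → par x ≡ v
    off-spine-child-of-root {x} x∈Tv x-off = parent-on-spine (on-spine? (par x))
      where
      x-leaf = off-spine-leaf x∈Tv x-off
      par-x∈Tv = ∈T-parent x∈Tv (λ x≡v → x-off (subst OnSpine (sym x≡v) v-on-spine))
      level-of : ∀ {z} → z ∈T v → ∃[ i ] z ∈D[ i ]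
      level-of z∈Tv = Product.map₂ proj₂ (∈T⇒∈D z∈Tv)
      parent-on-spine : Dec (OnSpine (par x)) → par x ≡ v
      parent-on-spine (no par-x-off) = contradiction
        (off-spine-leaf par-x∈Tv par-x-off (~-sym (parent-adj (proj₂ (level-of x∈Tv)))))
        (grandparent-≢ (proj₂ (level-of x∈Tv)) (proj₂ (level-of par-x∈Tv)))
      parent-on-spine (yes (i , i≤k , si≡par-x)) = Sum.[ below-root , at-root ]′ (m≤n⇒m<n∨m≡n i≤k)
        where
        at-root : i ≡ k → par x ≡ v
        at-root refl = trans (sym si≡par-x) y↑v
        below-root : i < k → par x ≡ v
        below-root i<k = ⊥-elim (hub-neighbour-has-no-leaf
          (parent-adj (spine∈D (<⇒≤ i<k))) (parent-adj (spine∈D i<k))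
          (grandparent-≢ (spine∈D (<⇒≤ i<k)) (spine∈D i<k))
          hub-neighbours (subst (Leaf x) (sym si≡par-x) x-leaf))
          where
          hub-gray-free : g (s (suc i)) ≡ 0
          hub-gray-free = gray-free (spine∈T i<k) (λ si+1≡y → 1+n≢0 (spine-injective i<k z≤n si+1≡y))
          child : ∀ {z} → ParentEdge z (s (suc i)) → z ≡ s i ⊎ Leaf z (s (suc i))
          child {z} z↑ with on-spine? z
          ... | yes z-on = inj₁ (spine-child i<k z↑ z-on)
          ... | no z-off = inj₂ (subst (Leaf z) (proj₂ z↑) (off-spine-leaf (∈T-child (spine∈T i<k) z↑) z-off))
          hub-neighbours : ∀ {z} → s (suc i) ~ z → z ≡ s i ⊎ z ≡ par (s (suc i)) ⊎ Leaf z (s (suc i))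
          hub-neighbours si+1~z with g≡0⇒parent-or-child hub-gray-free si+1~z
          ... | inj₁ z≡par = inj₂ (inj₁ z≡par)
          ... | inj₂ z↑ = Sum.map₂ inj₂ (child z↑)

    off-spine-unique : ∀ {x x′} → x ∈T v → ¬ OnSpine x → x′ ∈T v → ¬ OnSpine x′ → x ≡ x′
    off-spine-unique x∈Tv x-off x′∈Tv x′-off = leaves-coincide
      (subst (_ ~_) (off-spine-child-of-root x′∈Tv x′-off) (∈T⇒parent-adj x′∈Tv))
      (subst (Leaf _) (off-spine-child-of-root x∈Tv x-off) (off-spine-leaf x∈Tv x-off))
      (subst (Leaf _) (off-spine-child-of-root x′∈Tv x′-off) (off-spine-leaf x′∈Tv x′-off))

    record Enumeration (M : ℕ) (u : ℕ → Fin n) : Set where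
      field
        injective          : InjectiveOn M u
        members            : ∀ {i} → i ≤ M → u i ∈T v
        covers             : ∀ {x} → x ∈T v → ∃[ i ] (i ≤ M × u i ≡ x)
        parent-consecutive : ∀ {i j} → i ≤ M → j ≤ M → par (u i) ≡ u j → j ≡ suc i ⊎ i ≡ suc j
        consecutive-parent : ∀ {i} → i < M → par (u i) ≡ u (suc i) ⊎ par (u (suc i)) ≡ u i
        starts-at-y        : u 0 ≡ y

    enumeration⇒path : ∀ {M u} → Enumeration M u → PathWithGrayAtEnd v
    enumeration⇒path {M} {u} E = M , u , (λ _ _ → injective) , covering , edges ,
      λ x z x∈VT xz-gray → inj₁ (trans (gray⇒≡y (to ∈VT⇔∈T x∈VT) xz-gray) (sym starts-at-y))
      where
      open Enumeration E
      covering : ∀ x → x ∈ VT v ⇔ (∃[ i ] (i ≤ M × u i ≡ x))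
      covering x = mk⇔ (covers ∘ to ∈VT⇔∈T)
                       (λ (i , i≤M , ui≡x) → from ∈VT⇔∈T (subst (_∈T v) ui≡x (members i≤M)))
      member-edge : ∀ {i j} → i ≤ M → j ≤ M → ParentEdge (u i) (u j) → j ≡ suc i ⊎ i ≡ suc j
      member-edge i≤M j≤M = parent-consecutive i≤M j≤M ∘ proj₂
      parent-edge : ∀ {i j} → i ≤ M → par (u i) ≡ u j → ParentEdge (u i) (u j)
      parent-edge i≤M par-ui≡uj = ∈T⇒∈D₀₊ (members i≤M) , par-ui≡uj
      consecutive-black : ∀ {i} → i < M → T (black (u i) (u (suc i)))
      consecutive-black {i} i<M = from black⇔
        (Sum.map (parent-edge (<⇒≤ i<M)) (parent-edge i<M) (consecutive-parent i<M))
      black-sym : ∀ {x z} → T (black x z) → T (black z x)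
      black-sym = from black⇔ ∘ Sum.swap ∘ to black⇔
      edges : ∀ i j → i ≤ M → j ≤ M → TEdge v (u i) (u j) ⇔ (j ≡ suc i ⊎ i ≡ suc j)
      edges i j i≤M j≤M = mk⇔
        (λ (_ , _ , black-uiuj) → Sum.[ member-edge i≤M j≤M , Sum.swap ∘ member-edge j≤M i≤M ]′
                                       (to black⇔ black-uiuj))
        (λ consecutive → from ∈VT⇔∈T (members i≤M) , from ∈VT⇔∈T (members j≤M) ,
                         Sum.[ (λ { refl → consecutive-black j≤M })
                             , (λ { refl → black-sym (consecutive-black i≤M) }) ]′ consecutive)

    root∈T : v ∈T v
    root∈T = subst (_∈T v) y↑v (spine∈T ≤-refl)

    spine-trivial : y ≡ v → ∀ {z} → OnSpine z → z ≡ v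
    spine-trivial y≡v (i , i≤k , si≡z) = trans (sym si≡z) (trans (cong s i≡0) y≡v)
      where
      k≡0 = spine-injective ≤-refl z≤n (trans y↑v (sym y≡v))
      i≡0 = n≤0⇒n≡0 (subst (i ≤_) k≡0 i≤k)

    module AllOnSpine (all-on-spine : ∀ {x} → x ∈T v → OnSpine x) where
      enumeration : Enumeration k s
      enumeration = record
        { injective          = spine-injective
        ; members            = spine∈T
        ; covers             = all-on-spine
        ; parent-consecutive = λ i≤k j≤k par-si≡sj → inj₁ (parent-along-spine i≤k j≤k par-si≡sj)
        ; consecutive-parent = λ _ → inj₁ refl
        ; starts-at-y        = refl
        }

      tiny : y ≡ v → TinyTree v
      tiny y≡v = inj₁ λ z → mk⇔ (λ z∈VT → spine-trivial y≡v (all-on-spine (to ∈VT⇔∈T z∈VT)))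
                                (λ { refl → from ∈VT⇔∈T root∈T })

    module LeafAtRoot {w} (w∈Tv : w ∈T v) (w-off : ¬ OnSpine w) where
      u : ℕ → Fin n
      u = snoc (suc k) s w

      par-w≡v : par w ≡ v
      par-w≡v = off-spine-child-of-root w∈Tv w-off

      Position : ℕ → Set
      Position i = (i ≤ k × u i ≡ s i) ⊎ (i ≡ suc k × u i ≡ w)

      position : ∀ {i} → i ≤ suc k → Position i
      position i≤1+k = Sum.map (λ i<1+k → ≤-pred i<1+k , snoc-< s w i<1+k)
                                    (λ i≡1+k → i≡1+k , trans (cong u i≡1+k) (snoc-N (suc k) s w))
                                    (m≤n⇒m<n∨m≡n i≤1+k)

      on-spine-or-w : ∀ {x} → x ∈T v → OnSpine x ⊎ x ≡ w
      on-spine-or-w {x} x∈Tv = Sum.map₂ (λ x-off → off-spine-unique x∈Tv x-off w∈Tv w-off)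
                                             (toSum (on-spine? x))

      injective : InjectiveOn (suc k) u
      injective {i} {j} i≤ j≤ ui≡uj = compare (position i≤) (position j≤)
        where
        compare : Position i → Position j → i ≡ j
        compare (inj₁ (i≤k , ui≡si)) (inj₁ (j≤k , uj≡sj)) =
          spine-injective i≤k j≤k (trans (sym ui≡si) (trans ui≡uj uj≡sj))
        compare (inj₁ (i≤k , ui≡si)) (inj₂ (_ , uj≡w))    =
          ⊥-elim (w-off (i , i≤k , trans (sym ui≡si) (trans ui≡uj uj≡w)))
        compare (inj₂ (_ , ui≡w))    (inj₁ (j≤k , uj≡sj)) =
          ⊥-elim (w-off (j , j≤k , trans (sym uj≡sj) (trans (sym ui≡uj) ui≡w)))
        compare (inj₂ (i≡1+k , _))   (inj₂ (j≡1+k , _))   = trans i≡1+k (sym j≡1+k)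

      members : ∀ {i} → i ≤ suc k → u i ∈T v
      members i≤ = Sum.[ (λ (i≤k , ui≡si) → subst (_∈T v) (sym ui≡si) (spine∈T i≤k))
                            , (λ (_ , ui≡w) → subst (_∈T v) (sym ui≡w) w∈Tv) ]′ (position i≤)

      covers : ∀ {x} → x ∈T v → ∃[ i ] (i ≤ suc k × u i ≡ x)
      covers x∈Tv = Sum.[ (λ (i , i≤k , si≡x) → i , m≤n⇒m≤1+n i≤k , trans (snoc-< s w (s≤s i≤k)) si≡x)
                             , (λ x≡w → suc k , ≤-refl , trans (snoc-N (suc k) s w) (sym x≡w)) ]′ (on-spine-or-w x∈Tv)

      parent-consecutive : ∀ {i j} → i ≤ suc k → j ≤ suc k → par (u i) ≡ u j → j ≡ suc i ⊎ i ≡ suc j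
      parent-consecutive {i} {j} i≤ j≤ par-ui≡uj = compare (position i≤) (position j≤)
        where
        compare : Position i → Position j → j ≡ suc i ⊎ i ≡ suc j
        compare (inj₁ (i≤k , ui≡si)) (inj₁ (j≤k , uj≡sj)) =
          inj₁ (parent-along-spine i≤k j≤k (trans (cong par (sym ui≡si)) (trans par-ui≡uj uj≡sj)))
        compare (inj₁ (i≤k , ui≡si)) (inj₂ (_ , uj≡w)) = ⊥-elim (Sum.[ below-root , at-root ]′ (m≤n⇒m<n∨m≡n i≤k))
          where
          par-si≡w = trans (cong par (sym ui≡si)) (trans par-ui≡uj uj≡w)
          below-root : i < k → ⊥
          below-root i<k = w-off (suc i , i<k , par-si≡w)
          at-root : i ≡ k → ⊥
          at-root refl = grandparent-≢ (proj₂ (proj₂ (∈T⇒∈D w∈Tv))) (subst (_∈D[ m ]) (sym par-w≡v) (root∈D y∈Tv))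
            (sym (trans (cong par par-w≡v) (trans (cong par (sym y↑v)) par-si≡w)))
        compare (inj₂ (i≡1+k , ui≡w)) (inj₁ (j≤k , uj≡sj)) =
          inj₂ (trans i≡1+k (cong suc (spine-injective ≤-refl j≤k (trans y↑v (trans (sym par-w≡v)
            (trans (cong par (sym ui≡w)) (trans par-ui≡uj uj≡sj)))))))
        compare (inj₂ (_ , ui≡w)) (inj₂ (_ , uj≡w)) =
          ⊥-elim (~-irrefl (subst (w ~_) (trans (cong par (sym ui≡w)) (trans par-ui≡uj uj≡w)) (∈T⇒parent-adj w∈Tv)))

      consecutive-parent : ∀ {i} → i < suc k → par (u i) ≡ u (suc i) ⊎ par (u (suc i)) ≡ u i
      consecutive-parent {i} i<1+k = Sum.[ below-root , at-root ]′ (m≤n⇒m<n∨m≡n (≤-pred i<1+k))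
        where
        below-root : i < k → par (u i) ≡ u (suc i) ⊎ par (u (suc i)) ≡ u i
        below-root i<k = inj₁ (trans (cong par (snoc-< s w i<1+k)) (sym (snoc-< s w (s≤s i<k))))
        at-root : i ≡ k → par (u i) ≡ u (suc i) ⊎ par (u (suc i)) ≡ u i
        at-root refl = inj₂ (trans (cong par (snoc-N (suc k) s w)) (trans par-w≡v (trans (sym y↑v) (sym (snoc-< s w i<1+k)))))

      enumeration : Enumeration (suc k) u
      enumeration = record
        { injective          = injective
        ; members            = members
        ; covers             = covers
        ; parent-consecutive = parent-consecutive
        ; consecutive-parent = consecutive-parent
        ; starts-at-y        = snoc-< {suc k} s w (s≤s z≤n)
        }

      tiny : y ≡ v → TinyTree v
      tiny y≡v = inj₂ (w , (λ w≡v → w-off (subst OnSpine (sym w≡v) v-on-spine))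
                        , from (deg≡1⇔leaf (∈T⇒parent-adj w∈Tv)) (off-spine-leaf w∈Tv w-off)
                        , λ z → mk⇔ (Sum.map₁ (spine-trivial y≡v) ∘ on-spine-or-w ∘ to ∈VT⇔∈T)
                                    (Sum.[ (λ { refl → from ∈VT⇔∈T root∈T })
                                              , (λ { refl → from ∈VT⇔∈T w∈Tv }) ]′))

    shape : PathWithGrayAtEnd v × GrayAtRootCriterion v
    shape = by-cases (any? λ w → (w ∈? VT v) ×-dec ¬? (on-spine? w))
      where
      criterion : (y ≡ v → TinyTree v) → GrayAtRootCriterion v
      criterion tiny x z x∈VT xz-gray =
        mk⇔ (λ x≡v → tiny (trans (sym (gray⇒≡y (to ∈VT⇔∈T x∈VT) xz-gray)) x≡v))
            (tiny-tree⇒gray-at-root x∈VT xz-gray)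
      by-cases : Dec (∃ λ w → w ∈ VT v × ¬ OnSpine w) → PathWithGrayAtEnd v × GrayAtRootCriterion v
      by-cases (yes (w , w∈VT , w-off)) = enumeration⇒path enumeration , criterion tiny
        where open LeafAtRoot (to ∈VT⇔∈T w∈VT) w-off
      by-cases (no no-off-spine) = enumeration⇒path enumeration , criterion tiny
        where
        open AllOnSpine (λ x∈Tv → decidable-stable (on-spine? _) λ x-off →
                                    no-off-spine (_ , from ∈VT⇔∈T x∈Tv , x-off))

  part-ii : ∀ {v} → gT v ≡ 1 → PathWithGrayAtEnd v × GrayAtRootCriterion v
  part-ii gT≡1 with gT≡1⇒ gT≡1
  ... | y , y∈Tv , gray-free = Spine.shape y∈Tv gray-free

lemma4p6 : (ℓ : ℕ) → 14 ≤ ℓ →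
    {n : ℕ} (G : Graph n) → Saturated G ℓ →
    (P : List (ℕ → Fin n)) → Construction.MaximalPathFamily G ℓ P →
    (S : Subset n) → Construction.MaximalGoodSet G ℓ P S →
    (par : Fin n → Fin n) → Construction.WithS.ValidParent G ℓ S par →
    (v : Fin n) → T (Construction.WithS.inD G ℓ S v) →
      (Construction.WithS.WithPar.gT G ℓ S par v ≡ 0 →
         Construction.deg G ℓ v ≡ 1)
    × (Construction.WithS.WithPar.gT G ℓ S par v ≡ 1 →
         Construction.WithS.WithPar.PathWithGrayAtEnd G ℓ S par v
       × Construction.WithS.WithPar.GrayAtRootCriterion G ℓ S par v)
lemma4p6 ℓ 14≤ℓ G sat _ _ S _ par valid v v∈D = part-i v∈D , part-ii
  where open TreeShape G ℓ (≤-trans (s≤s (s≤s (s≤s z≤n))) 14≤ℓ) sat S par valid
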